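{- If $n \geq 4$, then the strip graph $G_n$ satisfies $\operatorname{gon}(G_n) \geq 3$.
   Context: The strip graph $G_n$ has vertices $v_0,\ldots,v_n$ and an edge between $v_i$ and $v_j$ exactly when $|i-j|\in\{1,2\}$. For a finite connected graph, divisors are integer combinations of vertices, equivalent when their difference lies in the image of the graph Laplacian; the rank of $D$ is $-1$ if $D$ is not equivalent to an effective divisor, otherwise the largest $r$ such that $D-E$ is equivalent to an effective divisor for all effective $E$ of degree $r$. The gonality $\operatorname{gon}(G)$ is the minimum degree of a divisor of rank at least $1$. -}

module Defs where

open import Data.Nat as ℕ using (ℕ; zero; suc; ∣_-_∣)
open import Data.Fin using (Fin; toℕ) renaming (zero to fzero; suc to fsuc)
open import Data.Integer using (ℤ; +_; _+_; _-_; _*_; _≤_)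
open import Data.Product using (Σ; _×_)
open import Relation.Binary.PropositionalEquality using (_≡_)

sumℤ : {k : ℕ} → (Fin k → ℤ) → ℤ
sumℤ {zero}  f = + 0
sumℤ {suc k} f = f fzero + sumℤ (λ i → f (fsuc i))

-- Strip graph G_n : vertices v_0 … v_n (i.e. Fin (suc n)),
-- v_i ~ v_j iff |i - j| ∈ {1,2}.  Weight 1 on edges, 0 otherwise.
adjW : {n : ℕ} → Fin (suc n) → Fin (suc n) → ℤ
adjW i j with ∣ toℕ i - toℕ j ∣
... | 1 = + 1
... | 2 = + 1
... | _ = + 0

Divisor : ℕ → Set
Divisor n = Fin (suc n) → ℤ

deg : {n : ℕ} → Divisor n → ℤ
deg D = sumℤ D

Effective : {n : ℕ} → Divisor n → Set
Effective D = ∀ v → + 0 ≤ D v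

laplacian : {n : ℕ} → (Fin (suc n) → ℤ) → Divisor n
laplacian f v = sumℤ (λ w → adjW v w * (f v - f w))

_∼_ : {n : ℕ} → Divisor n → Divisor n → Set
_∼_ {n} D D' = Σ (Fin (suc n) → ℤ) (λ f → ∀ v → D v - D' v ≡ laplacian f v)

EquivEffective : {n : ℕ} → Divisor n → Set
EquivEffective {n} D = Σ (Divisor n) (λ E → Effective E × (D ∼ E))

_−ᴰ_ : {n : ℕ} → Divisor n → Divisor n → Divisor n
(D −ᴰ E) v = D v - E v

RankAtLeast : {n : ℕ} → ℕ → Divisor n → Set
RankAtLeast {n} r D =
  EquivEffective D ×
  (∀ (E : Divisor n) → Effective E → deg E ≡ + r → EquivEffective (D −ᴰ E))

GonalityAtLeast : ℕ → ℕ → Set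
GonalityAtLeast n k = ∀ (D : Divisor n) → RankAtLeast 1 D → + k ≤ deg D

-- Suppose D has rank ≥ 1 but degree ≤ 2. For a = 1, 2, 3 some effective Gₐ ∼ D has a chip on vₐ;
-- it has degree ≤ 2 and, vₐ being interior, at most one chip on each end vertex v₀, vₙ. A
-- maximum principle in the spirit of Dhar's burning algorithm shows that such a divisor is
-- v₁-reduced: if a firing script h keeping it effective were not maximal at v₁, each vertex where
-- h is maximal would need a chip for every edge to a non-maximal neighbour, and in the strip this
-- forces three chips in total or two on an end vertex. Reduced divisors are unique in their
-- class, so G₁ = G₂ = G₃ carries a chip on each of v₁, v₂, v₃: degree ≥ 3.

module Submission where

open import Defs
open import Algebra.Properties.CommutativeSemigroup using (x∙yz≈y∙xz)
open import Data.Empty using (⊥; ⊥-elim)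
open import Data.Fin using (Fin; toℕ; fromℕ<) renaming (zero to fzero; suc to fsuc)
open import Data.Fin.Properties using (toℕ-fromℕ<; toℕ-injective; toℕ≤pred[n]; _≟_)
open import Data.Integer using (ℤ; +_; _+_; _-_; _*_; -_; nonNegative)
import Data.Integer.Properties as ℤ
open import Data.Integer.Tactic.RingSolver using (solve-∀)
open import Data.List using (List; []; _∷_; map; length; allFin)
open import Data.List.Properties using (length-map)
open import Data.List.Membership.Propositional.Properties using (∈-allFin)
open import Data.List.Relation.Unary.All as All using (All; []; _∷_)
import Data.List.Relation.Unary.All.Properties as All
open import Data.List.Relation.Unary.Unique.Propositional using (Unique; []; _∷_)
open import Data.Nat as ℕ using (ℕ; zero; suc; ∣_-_∣; z≤n; s≤s)
import Data.Nat.Properties as ℕ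
open import Data.Product using (∃-syntax; _×_; _,_; proj₁; proj₂; map₁; map₂)
open import Data.Sum using (_⊎_; inj₁; inj₂)
open import Data.Vec.Functional using (updateAt)
open import Data.Vec.Functional.Properties using (updateAt-updates; updateAt-minimal)
open import Function using (_∘_; const)
open import Relation.Binary.PropositionalEquality
open import Relation.Nullary using (¬_; Dec; yes; no; contradiction)
import Relation.Unary as U

open import Algebra.Properties.CommutativeMonoid.Sum ℤ.+-0-commutativeMonoid
  using (sum; sum-cong-≗; sum-replicate-zero; ∑-distrib-+; ∑-comm)
open import Data.List.Extrema ℤ.≤-totalOrder using (argmax; f[xs]≤f[argmax])

-- The order on ℤ is opened only inside this module, so that the _≤_ in the statement of
-- theorem5p7 is the one on ℕ.
module _ where

  open import Data.Integer using (_≤_; _<_; _≤?_; +≤+)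

  3≰2 : ¬ (+ 3 ≤ + 2)
  3≰2 (+≤+ (s≤s (s≤s ())))

  2≰1 : ¬ (+ 2 ≤ + 1)
  2≰1 (+≤+ (s≤s ()))

  i<j⇒1≤j-i : ∀ {i j} → i < j → + 1 ≤ j - i
  i<j⇒1≤j-i {i} {j} i<j = begin
    + 1          ≡⟨ cancel i ⟨
    + 1 + i - i  ≤⟨ ℤ.+-monoˡ-≤ (- i) (ℤ.i<j⇒suc[i]≤j i<j) ⟩
    j - i        ∎
    where
    open ℤ.≤-Reasoning
    cancel : ∀ x → + 1 + x - x ≡ + 1
    cancel = solve-∀

  sumℤ≡sum : ∀ {k} (f : Fin k → ℤ) → sumℤ f ≡ sum f
  sumℤ≡sum {zero}  f = refl
  sumℤ≡sum {suc k} f = cong (_+_ (f fzero)) (sumℤ≡sum (f ∘ fsuc))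

  sumℤ-cong : ∀ {k} {f g : Fin k → ℤ} → f ≗ g → sumℤ f ≡ sumℤ g
  sumℤ-cong {f = f} {g} f≗g = begin
    sumℤ f  ≡⟨ sumℤ≡sum f ⟩
    sum f   ≡⟨ sum-cong-≗ f≗g ⟩
    sum g   ≡⟨ sumℤ≡sum g ⟨
    sumℤ g  ∎
    where open ≡-Reasoning

  sumℤ-zero : ∀ {k} {f : Fin k → ℤ} → (∀ i → f i ≡ + 0) → sumℤ f ≡ + 0
  sumℤ-zero {k} {f} f≡0 = begin
    sumℤ f      ≡⟨ sumℤ-cong f≡0 ⟩
    sumℤ zeros  ≡⟨ sumℤ≡sum zeros ⟩
    sum zeros   ≡⟨ sum-replicate-zero k ⟩
    + 0         ∎
    where
    open ≡-Reasoning
    zeros : Fin k → ℤ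
    zeros = const (+ 0)

  sumℤ-distrib-+ : ∀ {k} (f g : Fin k → ℤ) → sumℤ (λ i → f i + g i) ≡ sumℤ f + sumℤ g
  sumℤ-distrib-+ f g = begin
    sumℤ (λ i → f i + g i)  ≡⟨ sumℤ≡sum (λ i → f i + g i) ⟩
    sum (λ i → f i + g i)   ≡⟨ ∑-distrib-+ f g ⟩
    sum f + sum g           ≡⟨ cong₂ _+_ (sumℤ≡sum f) (sumℤ≡sum g) ⟨
    sumℤ f + sumℤ g         ∎
    where open ≡-Reasoning

  sumℤ-comm : ∀ {k m} (F : Fin k → Fin m → ℤ) →
              sumℤ (λ i → sumℤ (F i)) ≡ sumℤ (λ j → sumℤ (λ i → F i j))
  sumℤ-comm F = begin
    sumℤ (λ i → sumℤ (F i))          ≡⟨ sumℤ-cong (λ i → sumℤ≡sum (F i)) ⟩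
    sumℤ (λ i → sum (F i))           ≡⟨ sumℤ≡sum (λ i → sum (F i)) ⟩
    sum (λ i → sum (F i))            ≡⟨ ∑-comm F ⟩
    sum (λ j → sum (λ i → F i j))    ≡⟨ sumℤ≡sum (λ j → sum (λ i → F i j)) ⟨
    sumℤ (λ j → sum (λ i → F i j))   ≡⟨ sumℤ-cong (λ j → sumℤ≡sum (λ i → F i j)) ⟨
    sumℤ (λ j → sumℤ (λ i → F i j))  ∎
    where open ≡-Reasoning

  sumℤ-neg : ∀ {k} (f : Fin k → ℤ) → sumℤ (λ i → - f i) ≡ - sumℤ f
  sumℤ-neg {zero}  f = refl
  sumℤ-neg {suc k} f = begin
    - f fzero + sumℤ (λ i → - f (fsuc i))  ≡⟨ cong (_+_ (- f fzero)) (sumℤ-neg (f ∘ fsuc)) ⟩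
    - f fzero + - sumℤ (f ∘ fsuc)          ≡⟨ ℤ.neg-distrib-+ (f fzero) _ ⟨
    - (f fzero + sumℤ (f ∘ fsuc))          ∎
    where open ≡-Reasoning

  sumℤ-nonneg : ∀ {k} {f : Fin k → ℤ} → (∀ i → + 0 ≤ f i) → + 0 ≤ sumℤ f
  sumℤ-nonneg {zero}  f≥0 = ℤ.≤-refl
  sumℤ-nonneg {suc k} f≥0 = ℤ.+-mono-≤ (f≥0 fzero) (sumℤ-nonneg (f≥0 ∘ fsuc))

  _[_]≔0 : ∀ {k} → (Fin k → ℤ) → Fin k → Fin k → ℤ
  f [ i ]≔0 = updateAt f i (const (+ 0))

  sumℤ-split : ∀ {k} (i : Fin k) (f : Fin k → ℤ) → sumℤ f ≡ f i + sumℤ (f [ i ]≔0)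
  sumℤ-split fzero    f = cong (_+_ (f fzero)) (sym (ℤ.+-identityˡ _))
  sumℤ-split (fsuc i) f = begin
    f fzero + sumℤ (f ∘ fsuc)
      ≡⟨ cong (_+_ (f fzero)) (sumℤ-split i (f ∘ fsuc)) ⟩
    f fzero + (f (fsuc i) + sumℤ f′)
      ≡⟨ x∙yz≈y∙xz ℤ.+-commutativeSemigroup (f fzero) (f (fsuc i)) _ ⟩
    f (fsuc i) + (f fzero + sumℤ f′)
      ∎
    where
    open ≡-Reasoning
    f′ = (f ∘ fsuc) [ i ]≔0

  sumOver : ∀ {A : Set} → List A → (A → ℤ) → ℤ
  sumOver []       f = + 0
  sumOver (x ∷ xs) f = f x + sumOver xs f

  sumOver-cong : ∀ {A : Set} {f g : A → ℤ} {xs} →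
                 All (λ x → f x ≡ g x) xs → sumOver xs f ≡ sumOver xs g
  sumOver-cong []             = refl
  sumOver-cong (fx≡gx ∷ eqs) = cong₂ _+_ fx≡gx (sumOver-cong eqs)

  length≤sumOver : ∀ {A : Set} {f : A → ℤ} {xs} →
                   All (λ x → + 1 ≤ f x) xs → + length xs ≤ sumOver xs f
  length≤sumOver []             = ℤ.≤-refl
  length≤sumOver (1≤fx ∷ 1≤fxs) = ℤ.+-mono-≤ 1≤fx (length≤sumOver 1≤fxs)

  sumOver≤sumℤ : ∀ {k} {f : Fin k → ℤ} {is} →
                 (∀ i → + 0 ≤ f i) → Unique is → sumOver is f ≤ sumℤ f
  sumOver≤sumℤ f≥0 [] = sumℤ-nonneg f≥0
  sumOver≤sumℤ {f = f} {i ∷ is} f≥0 (i∉is ∷ unique) = begin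
    f i + sumOver is f   ≡⟨ cong (_+_ (f i)) (sumOver-cong (All.map untouched i∉is)) ⟩
    f i + sumOver is f₀  ≤⟨ ℤ.+-monoʳ-≤ (f i) (sumOver≤sumℤ f₀≥0 unique) ⟩
    f i + sumℤ f₀        ≡⟨ sumℤ-split i f ⟨
    sumℤ f               ∎
    where
    open ℤ.≤-Reasoning
    f₀ = f [ i ]≔0
    untouched : ∀ {j} → i ≢ j → f j ≡ f₀ j
    untouched i≢j = sym (updateAt-minimal _ i f (i≢j ∘ sym))
    f₀≥0 : ∀ j → + 0 ≤ f₀ j
    f₀≥0 j with j ≟ i
    ... | yes refl = ℤ.≤-reflexive (sym (updateAt-updates i f))
    ... | no  j≢i  = subst (+ 0 ≤_) (untouched (j≢i ∘ sym)) (f≥0 j)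

  length≤sumℤ : ∀ {k} {f : Fin k → ℤ} {is} → (∀ i → + 0 ≤ f i) → Unique is →
                All (λ i → + 1 ≤ f i) is → + length is ≤ sumℤ f
  length≤sumℤ f≥0 unique 1≤f = ℤ.≤-trans (length≤sumOver 1≤f) (sumOver≤sumℤ f≥0 unique)

  adjW-sym : ∀ {n} (i j : Fin (suc n)) → adjW i j ≡ adjW j i
  adjW-sym i j rewrite ℕ.∣-∣-comm (toℕ i) (toℕ j) = refl

  adjW-01 : ∀ {n} (i j : Fin (suc n)) → adjW i j ≡ + 0 ⊎ adjW i j ≡ + 1
  adjW-01 i j with ∣ toℕ i - toℕ j ∣
  ... | 0                 = inj₁ refl
  ... | 1                 = inj₂ refl
  ... | 2                 = inj₂ refl
  ... | suc (suc (suc _)) = inj₁ refl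

  laplacian-neg : ∀ {n} (f : Fin (suc n) → ℤ) v → laplacian (λ w → - f w) v ≡ - laplacian f v
  laplacian-neg f v = begin
    sumℤ (λ w → adjW v w * (- f v - - f w))
      ≡⟨ sumℤ-cong (λ w → distrib (adjW v w) (f v) (f w)) ⟩
    sumℤ (λ w → - (adjW v w * (f v - f w)))
      ≡⟨ sumℤ-neg (λ w → adjW v w * (f v - f w)) ⟩
    - laplacian f v
      ∎
    where
    open ≡-Reasoning
    distrib : ∀ a x y → a * (- x - - y) ≡ - (a * (x - y))
    distrib = solve-∀

  laplacian-+ : ∀ {n} (f g : Fin (suc n) → ℤ) v →
                laplacian (λ w → f w + g w) v ≡ laplacian f v + laplacian g v
  laplacian-+ f g v = begin
    sumℤ (λ w → adjW v w * ((f v + g v) - (f w + g w)))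
      ≡⟨ sumℤ-cong (λ w → distrib (adjW v w) (f v) (g v) (f w) (g w)) ⟩
    sumℤ (λ w → adjW v w * (f v - f w) + adjW v w * (g v - g w))
      ≡⟨ sumℤ-distrib-+ (λ w → adjW v w * (f v - f w)) (λ w → adjW v w * (g v - g w)) ⟩
    laplacian f v + laplacian g v
      ∎
    where
    open ≡-Reasoning
    distrib : ∀ a x y x′ y′ → a * ((x + y) - (x′ + y′)) ≡ a * (x - x′) + a * (y - y′)
    distrib = solve-∀

  laplacian-const : ∀ {n} {f : Fin (suc n) → ℤ} {c} →
                    (∀ w → f w ≡ c) → ∀ v → laplacian f v ≡ + 0
  laplacian-const {f = f} {c} f≡c v = sumℤ-zero λ w → begin
    adjW v w * (f v - f w)  ≡⟨ cong₂ (λ x y → adjW v w * (x - y)) (f≡c v) (f≡c w) ⟩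
    adjW v w * (c - c)      ≡⟨ cong (adjW v w *_) (ℤ.+-inverseʳ c) ⟩
    adjW v w * + 0          ≡⟨ ℤ.*-zeroʳ (adjW v w) ⟩
    + 0                     ∎
    where open ≡-Reasoning

  deg-laplacian : ∀ {n} (f : Fin (suc n) → ℤ) → deg (laplacian f) ≡ + 0
  deg-laplacian f = self-inverse (begin
    sumℤ (λ v → sumℤ (λ w → F v w))    ≡⟨ sumℤ-comm F ⟩
    sumℤ (λ w → sumℤ (λ v → F v w))    ≡⟨ sumℤ-cong (λ w → sumℤ-cong (antisymmetric w)) ⟩
    sumℤ (λ w → sumℤ (λ v → - F w v))  ≡⟨ sumℤ-cong (λ w → sumℤ-neg (F w)) ⟩
    sumℤ (λ w → - sumℤ (F w))          ≡⟨ sumℤ-neg (λ w → sumℤ (F w)) ⟩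
    - sumℤ (λ w → sumℤ (F w))          ∎)
    where
    open ≡-Reasoning
    F : _ → _ → ℤ
    F v w = adjW v w * (f v - f w)
    flip : ∀ a x y → a * (x - y) ≡ - (a * (y - x))
    flip = solve-∀
    antisymmetric : ∀ w v → F v w ≡ - F w v
    antisymmetric w v rewrite adjW-sym v w = flip (adjW w v) (f v) (f w)
    self-inverse : ∀ {x} → x ≡ - x → x ≡ + 0
    self-inverse {+ zero} _ = refl

  ∼-sym : ∀ {n} {D D′ : Divisor n} → D ∼ D′ → D′ ∼ D
  ∼-sym {D = D} {D′} (f , D-D′≡Lf) = (λ w → - f w) , λ v → begin
    D′ v - D v                 ≡⟨ swap (D v) (D′ v) ⟩
    - (D v - D′ v)             ≡⟨ cong -_ (D-D′≡Lf v) ⟩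
    - laplacian f v            ≡⟨ laplacian-neg f v ⟨
    laplacian (λ w → - f w) v  ∎
    where
    open ≡-Reasoning
    swap : ∀ x y → y - x ≡ - (x - y)
    swap = solve-∀

  ∼-trans : ∀ {n} {D D′ D″ : Divisor n} → D ∼ D′ → D′ ∼ D″ → D ∼ D″
  ∼-trans {D = D} {D′} {D″} (f , D-D′≡Lf) (g , D′-D″≡Lg) =
    (λ w → f w + g w) , λ v → begin
    D v - D″ v                     ≡⟨ telescope (D v) (D′ v) (D″ v) ⟩
    (D v - D′ v) + (D′ v - D″ v)   ≡⟨ cong₂ _+_ (D-D′≡Lf v) (D′-D″≡Lg v) ⟩
    laplacian f v + laplacian g v  ≡⟨ laplacian-+ f g v ⟨
    laplacian (λ w → f w + g w) v  ∎
    where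
    open ≡-Reasoning
    telescope : ∀ x y z → x - z ≡ (x - y) + (y - z)
    telescope = solve-∀

  ∼⇒deg≡ : ∀ {n} {D D′ : Divisor n} → D ∼ D′ → deg D ≡ deg D′
  ∼⇒deg≡ {D = D} {D′} (f , D-D′≡Lf) = begin
    sumℤ D                             ≡⟨ sumℤ-cong D≡D′+Lf ⟩
    sumℤ (λ v → D′ v + laplacian f v)  ≡⟨ sumℤ-distrib-+ D′ (laplacian f) ⟩
    sumℤ D′ + deg (laplacian f)        ≡⟨ cong (_+_ (sumℤ D′)) (deg-laplacian f) ⟩
    sumℤ D′ + + 0                      ≡⟨ ℤ.+-identityʳ (sumℤ D′) ⟩
    sumℤ D′                            ∎
    where
    open ≡-Reasoning
    split : ∀ x y → x ≡ y + (x - y)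
    split = solve-∀
    D≡D′+Lf : ∀ v → D v ≡ D′ v + laplacian f v
    D≡D′+Lf v = trans (split (D v) (D′ v)) (cong (_+_ (D′ v)) (D-D′≡Lf v))

  laplacian-at-maximum : ∀ {n} {h : Fin (suc n) → ℤ} {x ys} → (∀ w → h w ≤ h x) → Unique ys →
                         All (λ y → adjW x y ≡ + 1 × h y < h x) ys → + length ys ≤ laplacian h x
  laplacian-at-maximum {h = h} {x} h≤hx unique drops =
    length≤sumℤ term≥0 unique (All.map term≥1 drops)
    where
    term≥0 : ∀ w → + 0 ≤ adjW x w * (h x - h w)
    term≥0 w with adjW-01 x w
    ... | inj₁ a≡0 rewrite a≡0 = ℤ.≤-refl
    ... | inj₂ a≡1 rewrite a≡1 | ℤ.*-identityˡ (h x - h w) = ℤ.i≤j⇒0≤j-i (h≤hx w)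
    term≥1 : ∀ {y} → adjW x y ≡ + 1 × h y < h x → + 1 ≤ adjW x y * (h x - h y)
    term≥1 {y} (a≡1 , hy<hx) rewrite a≡1 | ℤ.*-identityˡ (h x - h y) = i<j⇒1≤j-i hy<hx

  -- For effective E this is q-reducedness (no set avoiding q can fire without going into debt),
  -- phrased via firing scripts: E − L h arises from E by firing each vertex v h(v) times.
  Reduced : ∀ {n} → Fin (suc n) → Divisor n → Set
  Reduced {n} q E =
    ∀ (h : Fin (suc n) → ℤ) → (∀ v → laplacian h v ≤ E v) → ∀ v → h v ≤ h q

  reduced-script-max : ∀ {n} {q} {E E′ : Divisor n} → Reduced q E → Effective E′ →
                       ((f , _) : E ∼ E′) → ∀ v → f v ≤ f q
  reduced-script-max {E = E} {E′} reduced E′≥0 (f , E-E′≡Lf) = reduced f λ v →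
    subst (_≤ E v) (E-E′≡Lf v) (ℤ.i-j≤i (E v) (E′ v) ⦃ nonNegative (E′≥0 v) ⦄)

  reduced-unique : ∀ {n} {q} {E E′ : Divisor n} → Effective E → Effective E′ →
                   Reduced q E → Reduced q E′ → E ∼ E′ → ∀ v → E v ≡ E′ v
  reduced-unique {q = q} {E} {E′} E≥0 E′≥0 reducedE reducedE′ E∼E′@(f , E-E′≡Lf) v =
    ℤ.i-j≡0⇒i≡j (E v) (E′ v) (trans (E-E′≡Lf v) (laplacian-const f-constant v))
    where
    f-constant : ∀ w → f w ≡ f q
    f-constant w = ℤ.≤-antisym
      (reduced-script-max reducedE E′≥0 E∼E′ w)
      (ℤ.neg-cancel-≤ (reduced-script-max reducedE′ E≥0 (∼-sym {D = E} E∼E′) w))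

  -- vₖ, with the junk value v₀ when k > n: every lemma about it assumes k ≤ n.
  vertex : ∀ {n} → ℕ → Fin (suc n)
  vertex {n} k with k ℕ.≤? n
  ... | yes k≤n = fromℕ< (s≤s k≤n)
  ... | no  _   = fzero

  toℕ-vertex : ∀ {n k} → k ℕ.≤ n → toℕ (vertex {n} k) ≡ k
  toℕ-vertex {n} {k} k≤n with k ℕ.≤? n
  ... | yes k≤n′ = toℕ-fromℕ< (s≤s k≤n′)
  ... | no  k≰n  = contradiction k≤n k≰n

  vertex-toℕ : ∀ {n} (i : Fin (suc n)) → vertex (toℕ i) ≡ i
  vertex-toℕ i = toℕ-injective (toℕ-vertex (toℕ≤pred[n] i))

  vertex-injective : ∀ {n a b} → a ℕ.≤ n → b ℕ.≤ n → vertex {n} a ≡ vertex b → a ≡ b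
  vertex-injective a≤n b≤n va≡vb =
    trans (sym (toℕ-vertex a≤n)) (trans (cong toℕ va≡vb) (toℕ-vertex b≤n))

  vertices-unique : ∀ {n ks} → All (ℕ._≤ n) ks → Unique ks → Unique (map (vertex {n}) ks)
  vertices-unique []           []              = []
  vertices-unique (k≤n ∷ ks≤n) (k∉ks ∷ unique) =
    All.map⁺ (All.zipWith (λ (j≤n , k≢j) → k≢j ∘ vertex-injective k≤n j≤n) (ks≤n , k∉ks))
    ∷ vertices-unique ks≤n unique

  data Adjacent : ℕ → ℕ → Set where
    right₁ : ∀ {k} → Adjacent k (1 ℕ.+ k)
    right₂ : ∀ {k} → Adjacent k (2 ℕ.+ k)
    left₁  : ∀ {k} → Adjacent (1 ℕ.+ k) k
    left₂  : ∀ {k} → Adjacent (2 ℕ.+ k) k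

  ∣k-d+k∣≡d : ∀ k d → ∣ k - d ℕ.+ k ∣ ≡ d
  ∣k-d+k∣≡d k d = trans (cong (λ m → ∣ k - m ∣) (ℕ.+-comm d k)) (ℕ.∣m-m+n∣≡n k d)

  ∣-∣-adjacent : ∀ {a b} → Adjacent a b → ∣ a - b ∣ ≡ 1 ⊎ ∣ a - b ∣ ≡ 2
  ∣-∣-adjacent (right₁ {k}) = inj₁ (∣k-d+k∣≡d k 1)
  ∣-∣-adjacent (right₂ {k}) = inj₂ (∣k-d+k∣≡d k 2)
  ∣-∣-adjacent (left₁ {k})  = inj₁ (trans (ℕ.∣-∣-comm (1 ℕ.+ k) k) (∣k-d+k∣≡d k 1))
  ∣-∣-adjacent (left₂ {k})  = inj₂ (trans (ℕ.∣-∣-comm (2 ℕ.+ k) k) (∣k-d+k∣≡d k 2))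

  adjW-at-distance : ∀ {n} (i j : Fin (suc n)) →
                     ∣ toℕ i - toℕ j ∣ ≡ 1 ⊎ ∣ toℕ i - toℕ j ∣ ≡ 2 → adjW i j ≡ + 1
  adjW-at-distance i j (inj₁ d≡1) rewrite d≡1 = refl
  adjW-at-distance i j (inj₂ d≡2) rewrite d≡2 = refl

  adjW-vertex : ∀ {n a b} → a ℕ.≤ n → b ℕ.≤ n → Adjacent a b →
                adjW (vertex {n} a) (vertex b) ≡ + 1
  adjW-vertex {a = a} {b} a≤n b≤n adjacent =
    adjW-at-distance (vertex a) (vertex b)
      (subst₂ (λ x y → ∣ x - y ∣ ≡ 1 ⊎ ∣ x - y ∣ ≡ 2)
              (sym (toℕ-vertex a≤n)) (sym (toℕ-vertex b≤n)) (∣-∣-adjacent adjacent))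

  rise-after-gap : ∀ {P : ℕ → Set} → U.Decidable P → ¬ P 0 → ¬ P 1 → ∀ {t} → P t →
                   ∃[ k ] (2 ℕ.+ k ℕ.≤ t × P (2 ℕ.+ k) × ¬ P (1 ℕ.+ k) × ¬ P k)
  rise-after-gap P? ¬P0 ¬P1 {zero}        P0 = contradiction P0 ¬P0
  rise-after-gap P? ¬P0 ¬P1 {suc zero}    P1 = contradiction P1 ¬P1
  -- The recursive calls are abstracted in the with, where the termination checker still sees
  -- them at suc k and k; made inside the with-function they would look unrelated to suc (suc k).
  rise-after-gap P? ¬P0 ¬P1 {suc (suc k)} Pt
    with P? (suc k) | P? k | rise-after-gap P? ¬P0 ¬P1 {suc k} | rise-after-gap P? ¬P0 ¬P1 {k}
  ... | yes P1+k | _      | rise₁ | _     = map₂ (map₁ (ℕ.m≤n⇒m≤o+n 1)) (rise₁ P1+k)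
  ... | no  _    | yes Pk | _     | rise₀ = map₂ (map₁ (ℕ.m≤n⇒m≤o+n 2)) (rise₀ Pk)
  ... | no ¬P1+k | no ¬Pk | _     | _     = k , ℕ.≤-refl , Pt , ¬P1+k , ¬Pk

  chip : ∀ {n} → Fin (suc n) → Divisor n
  chip v = updateAt (const (+ 0)) v (const (+ 1))

  chip-at : ∀ {n} (v : Fin (suc n)) → chip v v ≡ + 1
  chip-at v = updateAt-updates v (const (+ 0))

  chip-elsewhere : ∀ {n} {v w : Fin (suc n)} → w ≢ v → chip v w ≡ + 0
  chip-elsewhere {v = v} {w} w≢v = updateAt-minimal w v (const (+ 0)) w≢v

  chip-effective : ∀ {n} (v : Fin (suc n)) → Effective (chip v)
  chip-effective v w with w ≟ v
  ... | yes refl = subst (+ 0 ≤_) (sym (chip-at v)) (+≤+ z≤n)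
  ... | no  w≢v  = ℤ.≤-reflexive (sym (chip-elsewhere w≢v))

  deg-chip : ∀ {n} (v : Fin (suc n)) → deg (chip v) ≡ + 1
  deg-chip v = begin
    sumℤ (chip v)                    ≡⟨ sumℤ-split v (chip v) ⟩
    chip v v + sumℤ (chip v [ v ]≔0)  ≡⟨ cong₂ _+_ (chip-at v) (sumℤ-zero 0-elsewhere) ⟩
    + 1 + + 0                        ∎
    where
    open ≡-Reasoning
    0-elsewhere : ∀ w → (chip v [ v ]≔0) w ≡ + 0
    0-elsewhere w with w ≟ v
    ... | yes refl = updateAt-updates v (chip v)
    ... | no  w≢v  = trans (updateAt-minimal w v (chip v) w≢v) (chip-elsewhere w≢v)

  rank≥1⇒∃chip-at : ∀ {n} {D : Divisor n} → RankAtLeast 1 D → ∀ v →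
                    ∃[ G ] (Effective G × D ∼ G × + 1 ≤ G v)
  rank≥1⇒∃chip-at {D = D} (_ , rank≥1) v =
    let F , F≥0 , f , D-chip-F≡Lf = rank≥1 (chip v) (chip-effective v) (deg-chip v)
    in (λ w → F w + chip v w)
       , (λ w → ℤ.+-mono-≤ (F≥0 w) (chip-effective v w))
       , (f , λ w → trans (regroup (D w) (F w) (chip v w)) (D-chip-F≡Lf w))
       , ℤ.+-mono-≤ (F≥0 v) (ℤ.≤-reflexive (sym (chip-at v)))
    where
    regroup : ∀ d x c → d - (x + c) ≡ (d - c) - x
    regroup = solve-∀

  deg≤2⇒≤1-elsewhere : ∀ {n} {E : Divisor n} {v w} → Effective E → deg E ≤ + 2 → + 1 ≤ E v →
                       w ≢ v → E w ≤ + 1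
  deg≤2⇒≤1-elsewhere {E = E} {v} {w} E≥0 degE≤2 1≤Ev w≢v = begin
    E w              ≡⟨ cancel (E w) (E v) ⟨
    E w + E v - E v  ≤⟨ ℤ.+-mono-≤ Ew+Ev≤2 (ℤ.neg-mono-≤ 1≤Ev) ⟩
    + 1              ∎
    where
    open ℤ.≤-Reasoning
    cancel : ∀ x y → x + y - y ≡ x
    cancel = solve-∀
    Ew+Ev≤2 : E w + E v ≤ + 2
    Ew+Ev≤2 = begin
      E w + E v               ≡⟨ cong (_+_ (E w)) (ℤ.+-identityʳ (E v)) ⟨
      sumOver (w ∷ v ∷ []) E  ≤⟨ sumOver≤sumℤ E≥0 ((w≢v ∷ []) ∷ [] ∷ []) ⟩
      deg E                   ≤⟨ degE≤2 ⟩
      + 2                     ∎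

  module _ {n} (4≤n : 4 ℕ.≤ n) where

    1≤n : 1 ℕ.≤ n
    1≤n = ℕ.≤-trans (ℕ.m≤m+n 1 3) 4≤n

    2≤n : 2 ℕ.≤ n
    2≤n = ℕ.≤-trans (ℕ.m≤m+n 2 2) 4≤n

    3≤n : 3 ℕ.≤ n
    3≤n = ℕ.≤-trans (ℕ.m≤m+n 3 1) 4≤n

    module MaximumPrinciple
      {E : Divisor n} (E≥0 : Effective E) (degE≤2 : deg E ≤ + 2)
      (E₀≤1 : E (vertex 0) ≤ + 1) (Eₙ≤1 : E (vertex n) ≤ + 1)
      (h : Fin (suc n) → ℤ) (Lh≤E : ∀ v → laplacian h v ≤ E v)
      where

      top : Fin (suc n)
      top = argmax h fzero (allFin (suc n))

      h≤h[top] : ∀ v → h v ≤ h top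
      h≤h[top] v = All.lookup (f[xs]≤f[argmax] {f = h} fzero (allFin (suc n))) (∈-allFin v)

      Top : ℕ → Set
      Top k = h top ≤ h (vertex k)

      Top? : U.Decidable Top
      Top? k = h top ≤? h (vertex k)

      top-is-Top : Top (toℕ top)
      top-is-Top = subst (λ v → h top ≤ h v) (sym (vertex-toℕ top)) ℤ.≤-refl

      Drop : ℕ → ℕ → Set
      Drop k j = j ℕ.≤ n × Adjacent k j × ¬ Top j

      #drops≤E : ∀ {k js} → k ℕ.≤ n → Top k → All (Drop k) js → Unique js →
                 + length js ≤ E (vertex k)
      #drops≤E {k} {js} k≤n Tₖ drops unique = begin
        + length js               ≡⟨ cong +_ (length-map vertex js) ⟨
        + length (map vertex js)  ≤⟨ laplacian-at-maximum (λ w → ℤ.≤-trans (h≤h[top] w) Tₖ)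
                                       (vertices-unique (All.map proj₁ drops) unique)
                                       (All.map⁺ (All.map edge-down drops)) ⟩
        laplacian h (vertex k)    ≤⟨ Lh≤E (vertex k) ⟩
        E (vertex k)              ∎
        where
        open ℤ.≤-Reasoning
        edge-down : ∀ {j} → Drop k j → adjW (vertex k) (vertex j) ≡ + 1 × h (vertex j) < h (vertex k)
        edge-down (j≤n , adjacent , ¬Tⱼ) =
          adjW-vertex k≤n j≤n adjacent , ℤ.<-≤-trans (ℤ.≰⇒> ¬Tⱼ) Tₖ

      ¬3≤sumOver : ∀ {ks} → All (ℕ._≤ n) ks → Unique ks → ¬ (+ 3 ≤ sumOver (map vertex ks) E)
      ¬3≤sumOver ks≤n unique 3≤ =
        3≰2 (ℤ.≤-trans 3≤ (ℤ.≤-trans (sumOver≤sumℤ E≥0 (vertices-unique ks≤n unique)) degE≤2))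

      left-end : Top 0 → ¬ Top 1 → ⊥
      left-end T₀ ¬T₁ = conclude (Top? 2) (Top? 3)
        where
        drop₁ : ∀ {k} → Adjacent k 1 → Drop k 1
        drop₁ adjacent = 1≤n , adjacent , ¬T₁
        E₀≥1 : + 1 ≤ E (vertex 0)
        E₀≥1 = #drops≤E z≤n T₀ (drop₁ right₁ ∷ []) ([] ∷ [])
        conclude : Dec (Top 2) → Dec (Top 3) → ⊥
        conclude (no ¬T₂) _ = 2≰1 (ℤ.≤-trans E₀≥2 E₀≤1)
          where
          E₀≥2 : + 2 ≤ E (vertex 0)
          E₀≥2 = #drops≤E z≤n T₀ (drop₁ right₁ ∷ (2≤n , right₂ , ¬T₂) ∷ [])
                              (((λ ()) ∷ []) ∷ [] ∷ [])
        conclude (yes T₂) (no ¬T₃) =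
          ¬3≤sumOver (z≤n ∷ 2≤n ∷ []) (((λ ()) ∷ []) ∷ [] ∷ [])
            (ℤ.+-mono-≤ E₀≥1 (ℤ.+-mono-≤ E₂≥2 ℤ.≤-refl))
          where
          E₂≥2 : + 2 ≤ E (vertex 2)
          E₂≥2 = #drops≤E 2≤n T₂ (drop₁ left₁ ∷ (3≤n , right₁ , ¬T₃) ∷ [])
                              (((λ ()) ∷ []) ∷ [] ∷ [])
        conclude (yes T₂) (yes T₃) =
          ¬3≤sumOver (z≤n ∷ 2≤n ∷ 3≤n ∷ [])
            (((λ ()) ∷ (λ ()) ∷ []) ∷ ((λ ()) ∷ []) ∷ [] ∷ [])
            (ℤ.+-mono-≤ E₀≥1 (ℤ.+-mono-≤ E₂≥1 (ℤ.+-mono-≤ E₃≥1 ℤ.≤-refl)))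
          where
          E₂≥1 : + 1 ≤ E (vertex 2)
          E₂≥1 = #drops≤E 2≤n T₂ (drop₁ left₁ ∷ []) ([] ∷ [])
          E₃≥1 : + 1 ≤ E (vertex 3)
          E₃≥1 = #drops≤E 3≤n T₃ (drop₁ left₂ ∷ []) ([] ∷ [])

      rise : ∀ k → 2 ℕ.+ k ℕ.≤ n → Top (2 ℕ.+ k) → ¬ Top (1 ℕ.+ k) → ¬ Top k → ⊥
      rise k 2+k≤n T₂₊ₖ ¬T₁₊ₖ ¬Tₖ = conclude (ℕ.m≤n⇒m<n∨m≡n 2+k≤n)
        where
        1+k≤n : 1 ℕ.+ k ℕ.≤ n
        1+k≤n = ℕ.≤-trans (ℕ.n≤1+n (1 ℕ.+ k)) 2+k≤n
        drop₁₊ₖ : ∀ {m} → Adjacent m (1 ℕ.+ k) → Drop m (1 ℕ.+ k)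
        drop₁₊ₖ adjacent = 1+k≤n , adjacent , ¬T₁₊ₖ
        dropₖ : Drop (2 ℕ.+ k) k
        dropₖ = ℕ.≤-trans (ℕ.n≤1+n k) 1+k≤n , left₂ , ¬Tₖ
        E₂₊ₖ≥2 : + 2 ≤ E (vertex (2 ℕ.+ k))
        E₂₊ₖ≥2 = #drops≤E 2+k≤n T₂₊ₖ (drop₁₊ₖ left₁ ∷ dropₖ ∷ [])
                                     (((λ ()) ∷ []) ∷ [] ∷ [])
        conclude : 2 ℕ.+ k ℕ.< n ⊎ 2 ℕ.+ k ≡ n → ⊥
        conclude (inj₂ 2+k≡n) =
          2≰1 (ℤ.≤-trans (subst (λ m → + 2 ≤ E (vertex m)) 2+k≡n E₂₊ₖ≥2) Eₙ≤1)
        conclude (inj₁ 3+k≤n) = beyond (Top? (3 ℕ.+ k))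
          where
          beyond : Dec (Top (3 ℕ.+ k)) → ⊥
          beyond (yes T₃₊ₖ) =
            ¬3≤sumOver (2+k≤n ∷ 3+k≤n ∷ []) (((λ ()) ∷ []) ∷ [] ∷ [])
              (ℤ.+-mono-≤ E₂₊ₖ≥2 (ℤ.+-mono-≤ E₃₊ₖ≥1 ℤ.≤-refl))
            where
            E₃₊ₖ≥1 : + 1 ≤ E (vertex (3 ℕ.+ k))
            E₃₊ₖ≥1 = #drops≤E 3+k≤n T₃₊ₖ (drop₁₊ₖ left₂ ∷ []) ([] ∷ [])
          beyond (no ¬T₃₊ₖ) =
            ¬3≤sumOver (2+k≤n ∷ []) ([] ∷ []) (ℤ.+-mono-≤ E₂₊ₖ≥3 ℤ.≤-refl)
            where
            E₂₊ₖ≥3 : + 3 ≤ E (vertex (2 ℕ.+ k))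
            E₂₊ₖ≥3 = #drops≤E 2+k≤n T₂₊ₖ
                       (drop₁₊ₖ left₁ ∷ dropₖ ∷ (3+k≤n , right₁ , ¬T₃₊ₖ) ∷ [])
                       (((λ ()) ∷ (λ ()) ∷ []) ∷ ((λ ()) ∷ []) ∷ [] ∷ [])

      v₁-maximal : ∀ v → h v ≤ h (vertex 1)
      v₁-maximal v with Top? 1 | Top? 0
      ... | yes T₁ | _      = ℤ.≤-trans (h≤h[top] v) T₁
      ... | no ¬T₁ | yes T₀ = ⊥-elim (left-end T₀ ¬T₁)
      ... | no ¬T₁ | no ¬T₀ =
        let k , 2+k≤t , T₂₊ₖ , ¬T₁₊ₖ , ¬Tₖ = rise-after-gap Top? ¬T₀ ¬T₁ top-is-Top
        in ⊥-elim (rise k (ℕ.≤-trans 2+k≤t (toℕ≤pred[n] top)) T₂₊ₖ ¬T₁₊ₖ ¬Tₖ)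

    deg≤2⇒v₁-reduced : ∀ {E : Divisor n} → Effective E → deg E ≤ + 2 →
                       E (vertex 0) ≤ + 1 → E (vertex n) ≤ + 1 → Reduced (vertex 1) E
    deg≤2⇒v₁-reduced E≥0 degE≤2 E₀≤1 Eₙ≤1 h Lh≤E =
      MaximumPrinciple.v₁-maximal E≥0 degE≤2 E₀≤1 Eₙ≤1 h Lh≤E

    rank≥1⇒deg≰2 : ∀ {D : Divisor n} → RankAtLeast 1 D → ¬ (deg D ≤ + 2)
    rank≥1⇒deg≰2 {D} rank≥1 degD≤2 = 3≰2 (begin
      + 3        ≤⟨ length≤sumℤ (G≥0 1) distinct G₁-chips ⟩
      deg (G 1)  ≤⟨ degG≤2 1 ⟩
      + 2        ∎)
      where
      open ℤ.≤-Reasoning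
      distinct : Unique (map vertex (1 ∷ 2 ∷ 3 ∷ []))
      distinct = vertices-unique (1≤n ∷ 2≤n ∷ 3≤n ∷ [])
                   (((λ ()) ∷ (λ ()) ∷ []) ∷ ((λ ()) ∷ []) ∷ [] ∷ [])
      representative : ∀ a → ∃[ G ] (Effective G × D ∼ G × + 1 ≤ G (vertex a))
      representative a = rank≥1⇒∃chip-at {D = D} rank≥1 (vertex a)
      G : ℕ → Divisor n
      G a = proj₁ (representative a)
      G≥0 : ∀ a → Effective (G a)
      G≥0 a = proj₁ (proj₂ (representative a))
      D∼G : ∀ a → D ∼ G a
      D∼G a = proj₁ (proj₂ (proj₂ (representative a)))
      G-chip : ∀ a → + 1 ≤ G a (vertex a)
      G-chip a = proj₂ (proj₂ (proj₂ (representative a)))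
      degG≤2 : ∀ a → deg (G a) ≤ + 2
      degG≤2 a = ℤ.≤-trans (ℤ.≤-reflexive (sym (∼⇒deg≡ {D = D} (D∼G a)))) degD≤2
      reduced : ∀ {a} → a ≢ 0 → a ℕ.≤ 3 → Reduced (vertex 1) (G a)
      reduced {a} a≢0 a≤3 =
        deg≤2⇒v₁-reduced (G≥0 a) (degG≤2 a)
          (≤1-at (a≢0 ∘ sym) z≤n) (≤1-at (ℕ.>⇒≢ a<n) ℕ.≤-refl)
        where
        a<n : a ℕ.< n
        a<n = ℕ.≤-<-trans a≤3 4≤n
        ≤1-at : ∀ {b} → b ≢ a → b ℕ.≤ n → G a (vertex b) ≤ + 1
        ≤1-at b≢a b≤n = deg≤2⇒≤1-elsewhere (G≥0 a) (degG≤2 a) (G-chip a)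
                          (b≢a ∘ vertex-injective b≤n (ℕ.<⇒≤ a<n))
      G₁-chip : ∀ {a} → a ≢ 0 → a ℕ.≤ 3 → + 1 ≤ G 1 (vertex a)
      G₁-chip {a} a≢0 a≤3 = subst (+ 1 ≤_) (sym G₁≡Gₐ) (G-chip a)
        where
        G₁≡Gₐ : G 1 (vertex a) ≡ G a (vertex a)
        G₁≡Gₐ = reduced-unique (G≥0 1) (G≥0 a)
                  (reduced (λ ()) (ℕ.m≤n+m 1 2)) (reduced a≢0 a≤3)
                  (∼-trans {D = G 1} {D} (∼-sym {D = D} (D∼G 1)) (D∼G a)) (vertex a)
      G₁-chips : All (λ v → + 1 ≤ G 1 v) (map vertex (1 ∷ 2 ∷ 3 ∷ []))
      G₁-chips = G₁-chip (λ ()) (ℕ.m≤n+m 1 2) ∷ G₁-chip (λ ()) (ℕ.n≤1+n 2)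
               ∷ G₁-chip (λ ()) ℕ.≤-refl ∷ []

open import Data.Nat using (_≤_)

theorem5p7 : (n : ℕ) → 4 ≤ n → GonalityAtLeast n 3
theorem5p7 n 4≤n D rank≥1 = ℤ.≮⇒≥ (rank≥1⇒deg≰2 4≤n {D} rank≥1 ∘ ℤ.i<j⇒i≤pred[j])
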